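{- Let $G$ be the adjacency graph of a generalized quadrangle $\mathrm{GQ}(s,t)$ with $s>1$ and $t>1$, and assume $G$ is vertex-transitive. Let $n$ be the number of vertices of $G$. Then $$2^{ -5/4}\, n^{1/4}\le \gamma^{\rm ID}_f(G)\le 2\, n^{2/5}.$$
   Context: A generalized quadrangle $\mathrm{GQ}(s,t)$ is an incidence structure of points and lines such that every line contains $s+1$ points, every point lies on $t+1$ lines, and for every point $P$ not on a line $L$ there is exactly one line through $P$ meeting $L$. Its adjacency graph has the points as vertices, two distinct points adjacent if they lie on a common line. For a graph $G=(V,E)$ with closed neighbourhoods $N[u]$, $\gamma^{\rm ID}_f(G)$ is the optimal value of the linear program: minimize $\sum_{u\in V}x_u$ subject to $\sum_{w\in N[u]}x_w\ge 1$ for all $u\in V$, $\sum_{w\in N[u]\Delta N[v]}x_w\ge 1$ for all distinct $u,v\in V$, and $0\le x_u\le 1$ for all $u$ ($\Delta$ is symmetric difference). -}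

module Defs where

open import Data.Nat using (ℕ; zero; suc; _+_; _*_)
open import Data.Fin using (Fin; zero; suc; _≟_)
open import Data.Bool using (Bool; true; false; _∧_; _∨_; _xor_; if_then_else_)
open import Data.Product using (Σ; _×_; _,_; ∃; ∃-syntax)
open import Data.Integer using (+_)
open import Data.Rational as ℚ using (ℚ; 0ℚ; 1ℚ)
open import Relation.Nullary using (¬_)
open import Relation.Nullary.Decidable using (⌊_⌋)
open import Relation.Binary.PropositionalEquality using (_≡_; _≢_)

count : ∀ {n} → (Fin n → Bool) → ℕ
count {zero}  f = 0
count {suc n} f = (if f zero then 1 else 0) + count (λ i → f (suc i))

anyF : ∀ {n} → (Fin n → Bool) → Bool
anyF {zero}  f = false
anyF {suc n} f = f zero ∨ anyF (λ i → f (suc i))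

sumℚ : ∀ {n} → (Fin n → ℚ) → ℚ
sumℚ {zero}  f = 0ℚ
sumℚ {suc n} f = f zero ℚ.+ sumℚ (λ i → f (suc i))

ℕtoℚ : ℕ → ℚ
ℕtoℚ n = + n ℚ./ 1

record GQ (s t : ℕ) : Set where
  field
    p l : ℕ
    I : Fin p → Fin l → Bool
    linePts : ∀ (L : Fin l) → count (λ P → I P L) ≡ suc s
    ptLines : ∀ (P : Fin p) → count (λ L → I P L) ≡ suc t
    partialLinear : ∀ (P Q : Fin p) (L M : Fin l) → P ≢ Q →
      I P L ≡ true → I Q L ≡ true → I P M ≡ true → I Q M ≡ true → L ≡ M
    gqAxiom : ∀ (P : Fin p) (L : Fin l) → I P L ≡ false →
      Σ (Fin l) λ M → (I P M ≡ true × (∃[ Q ] (I Q M ≡ true × I Q L ≡ true)))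
        × (∀ (M' : Fin l) → I P M' ≡ true → (∃[ Q ] (I Q M' ≡ true × I Q L ≡ true)) → M' ≡ M)

module _ {s t : ℕ} (Γ : GQ s t) where
  open GQ Γ

  Adj : Fin p → Fin p → Set
  Adj u v = u ≢ v × ∃[ L ] (I u L ≡ true × I v L ≡ true)

  inN : Fin p → Fin p → Bool
  inN u w = ⌊ u ≟ w ⌋ ∨ anyF (λ L → I u L ∧ I w L)

  VertexTransitive : Set
  VertexTransitive = ∀ (u v : Fin p) →
    Σ (Fin p → Fin p) λ σ → Σ (Fin p → Fin p) λ τ →
      (∀ x → τ (σ x) ≡ x) × (∀ x → σ (τ x) ≡ x) ×
      (∀ x y → (Adj x y → Adj (σ x) (σ y)) × (Adj (σ x) (σ y) → Adj x y)) ×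
      σ u ≡ v

  sumOver : (Fin p → Bool) → (Fin p → ℚ) → ℚ
  sumOver S x = sumℚ (λ w → if S w then x w else 0ℚ)

  -- feasibility for the fractional identifying code LP
  FeasibleID : (Fin p → ℚ) → Set
  FeasibleID x =
    (∀ u → 1ℚ ℚ.≤ sumOver (inN u) x) ×
    (∀ u v → u ≢ v → 1ℚ ℚ.≤ sumOver (λ w → inN u w xor inN v w) x) ×
    (∀ u → (0ℚ ℚ.≤ x u) × (x u ℚ.≤ 1ℚ))

{-# OPTIONS --safe #-}
module Submission where

open import Defs
open import Data.Nat as ℕ using (ℕ; _<_)
open import Data.Product using (Σ; _×_; _,_)
open import Data.Rational as ℚ using (ℚ)
open import Data.Fin using (Fin)
import Data.Nat.Properties as ℕP

-- The collinearity graph of a GQ(s,t) is regular: every closed neighbourhood has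
-- K = 1 + s(t+1) points and there are n = (s+1)(st+1) points. Summing the neighbourhood constraints of a feasible x over all vertices
-- gives n ≤ Kγ. Conversely the constant weight 1/(st) is feasible: N[u] and N[v] meet in
-- s+1 or t+1 points according as u and v are collinear or not, so |N[u] Δ N[v]| ≥ st, and
-- hence γ ≤ n/(st). It remains to show K⁴ ≤ 32n³ and n³ ≤ 32(st)⁵, which follow from
-- Higman's inequalities t ≤ s² and s ≤ t² (the second one applied to the dual quadrangle).
-- Higman's inequality is a variance argument: for non-collinear x, y let W = {x,y}⊥, which
-- has t+1 points, let V be the set of points collinear with neither x nor y, and for z ∈ V
-- let t_z = |W ∩ z⊥|. Double counting gives Σ t_z = (t+1)s(t−1) and
-- Σ t_z² ≤ (t+1)(s(t−1) + t(t−1)), and Cauchy–Schwarz (Σ t_z)² ≤ |V| Σ t_z² fails for t > s².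

module Counting where

  open import Data.Nat using (ℕ; zero; suc; _+_; _*_; _≤_; _<_; z≤n)
  import Data.Nat.Properties as ℕP
  open import Data.Fin using (Fin; zero; suc; _≟_)
  open import Data.Fin.Properties using (0≢1+n; suc-injective)
  open import Data.Bool using (Bool; true; false; _∧_; _∨_; not; _xor_; if_then_else_)
  open import Data.Bool.Properties using (¬-not; ∧-conicalˡ; ∧-conicalʳ)
  open import Data.Product using (_,_; ∃-syntax)
  open import Data.Sum using (inj₁; inj₂)
  open import Function using (_∘_)
  open import Relation.Nullary using (contradiction)
  open import Relation.Nullary.Decidable using (⌊_⌋; yes; no)
  open import Relation.Binary.PropositionalEquality
  open import Data.Nat.Tactic.RingSolver using (solve-∀)
  open import Algebra.Properties.Semiring.Sum ℕP.+-*-semiring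
    using (sum; sum-cong-≗; ∑-comm; ∑-distrib-+; *-distribˡ-sum; *-distribʳ-sum)

  𝟙 : Bool → ℕ
  𝟙 b = if b then 1 else 0

  𝟙-∧ : ∀ a b → 𝟙 (a ∧ b) ≡ 𝟙 a * 𝟙 b
  𝟙-∧ true  b = sym (ℕP.+-identityʳ (𝟙 b))
  𝟙-∧ false b = refl

  𝟙-mono : ∀ {a b} → (a ≡ true → b ≡ true) → 𝟙 a ≤ 𝟙 b
  𝟙-mono {false} _ = z≤n
  𝟙-mono {true}  h rewrite h refl = ℕP.≤-refl

  ≤-𝟙* : ∀ b {m n} → (b ≡ true → m ≤ n) → (b ≡ false → m ≡ 0) → m ≤ 𝟙 b * n
  ≤-𝟙* true  {n = n} present _ = ℕP.≤-trans (present refl) (ℕP.m≤m+n n 0)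
  ≤-𝟙* false _ absent = ℕP.≤-reflexive (absent refl)

  ≡-by-true : ∀ {a b} → (a ≡ true → b ≡ true) → (b ≡ true → a ≡ true) → a ≡ b
  ≡-by-true {true}  a⇒b _   = sym (a⇒b refl)
  ≡-by-true {false} {true}  _ b⇒a = b⇒a refl
  ≡-by-true {false} {false} _ _   = refl

  count-sum : ∀ {n} (f : Fin n → Bool) → count f ≡ sum (𝟙 ∘ f)
  count-sum {zero}  f = refl
  count-sum {suc n} f = cong (𝟙 (f zero) +_) (count-sum (f ∘ suc))

  count-cong : ∀ {n} {f g : Fin n → Bool} → (∀ i → f i ≡ g i) → count f ≡ count g
  count-cong {zero}  _ = refl
  count-cong {suc n} e = cong₂ (λ b c → 𝟙 b + c) (e zero) (count-cong (e ∘ suc))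

  count-mono : ∀ {n} {f g : Fin n → Bool} → (∀ i → f i ≡ true → g i ≡ true) → count f ≤ count g
  count-mono {zero}  _ = z≤n
  count-mono {suc n} h = ℕP.+-mono-≤ (𝟙-mono (h zero)) (count-mono (h ∘ suc))

  count-false : ∀ {n} {f : Fin n → Bool} → (∀ i → f i ≡ false) → count f ≡ 0
  count-false {n} {f} h = trans (count-cong h) (all-false n)
    where
    all-false : ∀ n → count {n} (λ _ → false) ≡ 0
    all-false zero    = refl
    all-false (suc n) = all-false n

  count-true : ∀ n → count {n} (λ _ → true) ≡ n
  count-true zero    = refl
  count-true (suc n) = cong suc (count-true n)

  count≡1 : ∀ {n} (f : Fin n → Bool) (a : Fin n) →
    f a ≡ true → (∀ i → f i ≡ true → i ≡ a) → count f ≡ 1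
  count≡1 f zero fa uniq rewrite fa =
    cong suc (count-false (λ i → ¬-not (λ fi → 0≢1+n (sym (uniq (suc i) fi)))))
  count≡1 f (suc a) fa uniq rewrite ¬-not {f zero} (λ f0 → 0≢1+n (uniq zero f0)) =
    count≡1 (f ∘ suc) a fa (λ i fi → suc-injective (uniq (suc i) fi))

  ⌊≟⌋⇒≡ : ∀ {n} {i a : Fin n} → ⌊ i ≟ a ⌋ ≡ true → i ≡ a
  ⌊≟⌋⇒≡ {i = i} {a} e with i ≟ a
  ... | yes i≡a = i≡a
  ... | no _    = contradiction e λ ()

  count-≟ : ∀ {n} (a : Fin n) → count (λ i → ⌊ i ≟ a ⌋) ≡ 1
  count-≟ a = count≡1 _ a (cong ⌊_⌋ (≡-≟-identity _≟_ refl)) (λ _ → ⌊≟⌋⇒≡)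

  count>0⇒∃ : ∀ {n} (f : Fin n → Bool) → 0 < count f → ∃[ i ] f i ≡ true
  count>0⇒∃ {suc n} f h with f zero in f0
  ... | true  = zero , f0
  ... | false = let i , fi = count>0⇒∃ (f ∘ suc) h in suc i , fi

  count<n⇒∃ : ∀ {n} (f : Fin n → Bool) → count f < n → ∃[ i ] f i ≡ false
  count<n⇒∃ {suc n} f h with f zero in f0
  ... | false = zero , f0
  ... | true  = let i , fi = count<n⇒∃ (f ∘ suc) (ℕP.≤-pred h) in suc i , fi

  anyF-intro : ∀ {n} (f : Fin n → Bool) (a : Fin n) → f a ≡ true → anyF f ≡ true
  anyF-intro f zero    fa rewrite fa = refl
  anyF-intro f (suc a) fa with f zero
  ... | true  = refl
  ... | false = anyF-intro (f ∘ suc) a fa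

  anyF-elim : ∀ {n} (f : Fin n → Bool) → anyF f ≡ true → ∃[ a ] f a ≡ true
  anyF-elim {suc n} f e with f zero in f0
  ... | true  = zero , f0
  ... | false = let a , fa = anyF-elim (f ∘ suc) e in suc a , fa

  private
    count-+ : ∀ {n} (f g : Fin n → Bool) → count f + count g ≡ sum (λ i → 𝟙 (f i) + 𝟙 (g i))
    count-+ f g = trans (cong₂ _+_ (count-sum f) (count-sum g)) (sym (∑-distrib-+ (𝟙 ∘ f) (𝟙 ∘ g)))

    count-+-pointwise₃ : ∀ {n} {f g h : Fin n → Bool} →
      (∀ i → 𝟙 (f i) + 𝟙 (g i) ≡ 𝟙 (h i)) → count f + count g ≡ count h
    count-+-pointwise₃ {f = f} {g} {h} e =
      trans (count-+ f g) (trans (sum-cong-≗ e) (sym (count-sum h)))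

    count-+-pointwise₄ : ∀ {n} {f g h k : Fin n → Bool} →
      (∀ i → 𝟙 (f i) + 𝟙 (g i) ≡ 𝟙 (h i) + 𝟙 (k i)) → count f + count g ≡ count h + count k
    count-+-pointwise₄ {f = f} {g} {h} {k} e =
      trans (count-+ f g) (trans (sum-cong-≗ e) (sym (count-+ h k)))

  count-∧-∧¬ : ∀ {n} (f g : Fin n → Bool) →
    count (λ i → f i ∧ g i) + count (λ i → f i ∧ not (g i)) ≡ count f
  count-∧-∧¬ f g = count-+-pointwise₃ (λ i → table (f i) (g i))
    where
    table : ∀ a b → 𝟙 (a ∧ b) + 𝟙 (a ∧ not b) ≡ 𝟙 a
    table true  true  = refl
    table true  false = refl
    table false _     = refl

  count-xor-∧ : ∀ {n} (f g : Fin n → Bool) →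
    count (λ i → f i xor g i) + count (λ i → f i ∧ g i) ≡ count (λ i → f i ∨ g i)
  count-xor-∧ f g = count-+-pointwise₃ (λ i → table (f i) (g i))
    where
    table : ∀ a b → 𝟙 (a xor b) + 𝟙 (a ∧ b) ≡ 𝟙 (a ∨ b)
    table true  true  = refl
    table true  false = refl
    table false true  = refl
    table false false = refl

  count-not : ∀ {n} (f : Fin n → Bool) → count f + count (not ∘ f) ≡ n
  count-not {n} f = trans (count-+-pointwise₃ (λ i → table (f i))) (count-true n)
    where
    table : ∀ a → 𝟙 a + 𝟙 (not a) ≡ 𝟙 true
    table true  = refl
    table false = refl

  count-∨-∧ : ∀ {n} (f g : Fin n → Bool) →
    count (λ i → f i ∨ g i) + count (λ i → f i ∧ g i) ≡ count f + count g
  count-∨-∧ f g = count-+-pointwise₄ (λ i → table (f i) (g i))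
    where
    table : ∀ a b → 𝟙 (a ∨ b) + 𝟙 (a ∧ b) ≡ 𝟙 a + 𝟙 b
    table true  true  = refl
    table true  false = refl
    table false true  = refl
    table false false = refl

  count≥2 : ∀ {n} (f : Fin n → Bool) {a b : Fin n} → a ≢ b → f a ≡ true → f b ≡ true → 2 ≤ count f
  count≥2 {n} f {a} {b} a≢b fa fb = begin
    2                                   ≡⟨ cong₂ _+_ (count-≟ a) (count-≟ b) ⟨
    count δa + count δb                 ≡⟨ count-∨-∧ δa δb ⟨
    count δa∨δb + count δa∧δb           ≡⟨ cong (count δa∨δb +_) disjoint ⟩
    count δa∨δb + 0                     ≡⟨ ℕP.+-identityʳ _ ⟩
    count δa∨δb                         ≤⟨ count-mono covered ⟩
    count f                             ∎
    where
    open ℕP.≤-Reasoning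
    δa δb δa∨δb δa∧δb : Fin n → Bool
    δa i = ⌊ i ≟ a ⌋
    δb i = ⌊ i ≟ b ⌋
    δa∨δb i = δa i ∨ δb i
    δa∧δb i = δa i ∧ δb i
    disjoint : count δa∧δb ≡ 0
    disjoint = count-false {n} {δa∧δb} λ i → ¬-not λ both →
      a≢b (trans (sym (⌊≟⌋⇒≡ (∧-conicalˡ (δa i) _ both))) (⌊≟⌋⇒≡ (∧-conicalʳ _ (δb i) both)))
    covered : ∀ i → δa∨δb i ≡ true → f i ≡ true
    covered i e with i ≟ a | i ≟ b
    ... | yes refl | _        = fa
    ... | no _     | yes refl = fb
    ... | no _     | no _     = contradiction e λ ()

  sum-mono-≤ : ∀ {n} {f g : Fin n → ℕ} → (∀ i → f i ≤ g i) → sum f ≤ sum g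
  sum-mono-≤ {zero}  _ = z≤n
  sum-mono-≤ {suc n} h = ℕP.+-mono-≤ (h zero) (sum-mono-≤ (h ∘ suc))

  𝟙*count : ∀ {n} b (f : Fin n → Bool) → 𝟙 b * count f ≡ count (λ i → b ∧ f i)
  𝟙*count true  f = ℕP.+-identityʳ (count f)
  𝟙*count {n} false f = sym (count-false {n} (λ _ → refl))

  sum-𝟙*-const : ∀ {n} (g : Fin n → Bool) (h : Fin n → ℕ) {c} →
    (∀ i → g i ≡ true → h i ≡ c) → sum (λ i → 𝟙 (g i) * h i) ≡ count g * c
  sum-𝟙*-const g h {c} h≡c = begin
    sum (λ i → 𝟙 (g i) * h i)  ≡⟨ sum-cong-≗ pointwise ⟩
    sum (λ i → 𝟙 (g i) * c)    ≡⟨ *-distribʳ-sum c (𝟙 ∘ g) ⟨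
    sum (𝟙 ∘ g) * c            ≡⟨ cong (_* c) (count-sum g) ⟨
    count g * c                ∎
    where
    open ≡-Reasoning
    pointwise : ∀ i → 𝟙 (g i) * h i ≡ 𝟙 (g i) * c
    pointwise i with g i in gi
    ... | true  = cong (_+ 0) (h≡c i gi)
    ... | false = refl

  sum-count-comm : ∀ {m n} (R : Fin m → Fin n → Bool) →
    sum (λ i → count (R i)) ≡ sum (λ j → count (λ i → R i j))
  sum-count-comm R = begin
    sum (λ i → count (R i))                  ≡⟨ sum-cong-≗ (λ i → count-sum (R i)) ⟩
    sum (λ i → sum (λ j → 𝟙 (R i j)))        ≡⟨ ∑-comm (λ i j → 𝟙 (R i j)) ⟩
    sum (λ j → sum (λ i → 𝟙 (R i j)))        ≡⟨ sum-cong-≗ (λ j → count-sum (λ i → R i j)) ⟨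
    sum (λ j → count (λ i → R i j))          ∎
    where open ≡-Reasoning

  double-count : ∀ {m n} (g : Fin n → Bool) (R : Fin m → Fin n → Bool) {c} →
    (∀ j → g j ≡ true → count (λ i → R i j) ≡ c) →
    sum (λ i → count (λ j → g j ∧ R i j)) ≡ count g * c
  double-count g R {c} H = begin
    sum (λ i → count (λ j → g j ∧ R i j))      ≡⟨ sum-count-comm (λ i j → g j ∧ R i j) ⟩
    sum (λ j → count (λ i → g j ∧ R i j))      ≡⟨ sum-cong-≗ (λ j → 𝟙*count (g j) (λ i → R i j)) ⟨
    sum (λ j → 𝟙 (g j) * count (λ i → R i j))  ≡⟨ sum-𝟙*-const g _ H ⟩
    count g * c                                ∎
    where open ≡-Reasoning

  sum-*-sum : ∀ {m n} (f : Fin m → ℕ) (g : Fin n → ℕ) →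
    sum f * sum g ≡ sum (λ i → sum (λ j → f i * g j))
  sum-*-sum f g = trans (*-distribʳ-sum (sum g) f) (sum-cong-≗ (λ i → *-distribˡ-sum (f i) g))

  sum-count² : ∀ {m n} (R : Fin m → Fin n → Bool) →
    sum (λ i → count (R i) * count (R i)) ≡ sum (λ j → sum (λ k → count (λ i → R i j ∧ R i k)))
  sum-count² R = begin
    sum (λ i → count (R i) * count (R i))
      ≡⟨ sum-cong-≗ (λ i → trans (cong₂ _*_ (count-sum (R i)) (count-sum (R i)))
                                 (sum-*-sum (𝟙 ∘ R i) (𝟙 ∘ R i))) ⟩
    sum (λ i → sum (λ j → sum (λ k → 𝟙 (R i j) * 𝟙 (R i k))))
      ≡⟨ ∑-comm (λ i j → sum (λ k → 𝟙 (R i j) * 𝟙 (R i k))) ⟩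
    sum (λ j → sum (λ i → sum (λ k → 𝟙 (R i j) * 𝟙 (R i k))))
      ≡⟨ sum-cong-≗ (λ j → ∑-comm (λ i k → 𝟙 (R i j) * 𝟙 (R i k))) ⟩
    sum (λ j → sum (λ k → sum (λ i → 𝟙 (R i j) * 𝟙 (R i k))))
      ≡⟨ sum-cong-≗ (λ j → sum-cong-≗ (λ k →
           trans (sum-cong-≗ (λ i → sym (𝟙-∧ (R i j) (R i k)))) (sym (count-sum (λ i → R i j ∧ R i k))))) ⟩
    sum (λ j → sum (λ k → count (λ i → R i j ∧ R i k)))
      ∎
    where open ≡-Reasoning

  private
    2mn≤m²+n²-ordered : ∀ {m n} → m ≤ n → 2 * (m * n) ≤ m * m + n * n
    2mn≤m²+n²-ordered {m} m≤n with ℕP.m≤n⇒∃[o]m+o≡n m≤n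
    ... | d , refl = subst (2 * (m * (m + d)) ≤_) (square-gap m d) (ℕP.m≤m+n _ (d * d))
      where
      square-gap : ∀ m d → 2 * (m * (m + d)) + d * d ≡ m * m + (m + d) * (m + d)
      square-gap = solve-∀

  2mn≤m²+n² : ∀ m n → 2 * (m * n) ≤ m * m + n * n
  2mn≤m²+n² m n with ℕP.≤-total m n
  ... | inj₁ m≤n = 2mn≤m²+n²-ordered m≤n
  ... | inj₂ n≤m = subst₂ _≤_ (cong (2 *_) (ℕP.*-comm n m)) (ℕP.+-comm (n * n) (m * m))
                           (2mn≤m²+n²-ordered n≤m)

  cauchy-schwarz : ∀ {n} (g : Fin n → Bool) (a : Fin n → ℕ) → (∀ i → g i ≡ false → a i ≡ 0) →
    sum a * sum a ≤ count g * sum (λ i → a i * a i)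
  cauchy-schwarz {n} g a vanish = ℕP.*-cancelˡ-≤ 2 (begin
    2 * (sum a * sum a)
      ≡⟨ cong (2 *_) (sum-*-sum a a) ⟩
    2 * sum (λ i → sum (λ j → a i * a j))
      ≡⟨ trans (*-distribˡ-sum 2 (λ i → sum (λ j → a i * a j)))
               (sum-cong-≗ (λ i → *-distribˡ-sum 2 (λ j → a i * a j))) ⟩
    sum (λ i → sum (λ j → 2 * (a i * a j)))
      ≤⟨ sum-mono-≤ (λ i → sum-mono-≤ (λ j → pointwise i j)) ⟩
    sum (λ i → sum (λ j → 𝟙 (g i) * a² j + a² i * 𝟙 (g j)))
      ≡⟨ trans (sum-cong-≗ (λ i → ∑-distrib-+ (λ j → 𝟙 (g i) * a² j) (λ j → a² i * 𝟙 (g j))))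
               (∑-distrib-+ (λ i → sum (λ j → 𝟙 (g i) * a² j)) (λ i → sum (λ j → a² i * 𝟙 (g j)))) ⟩
    sum (λ i → sum (λ j → 𝟙 (g i) * a² j)) + sum (λ i → sum (λ j → a² i * 𝟙 (g j)))
      ≡⟨ cong₂ _+_ (sum-*-sum (𝟙 ∘ g) a²) (sum-*-sum a² (𝟙 ∘ g)) ⟨
    sum (𝟙 ∘ g) * sum a² + sum a² * sum (𝟙 ∘ g)
      ≡⟨ cong (λ c → c * sum a² + sum a² * c) (count-sum g) ⟨
    count g * sum a² + sum a² * count g
      ≡⟨ cong (count g * sum a² +_) (trans (ℕP.*-comm (sum a²) (count g)) (sym (ℕP.+-identityʳ _))) ⟩
    2 * (count g * sum a²)
      ∎)
    where
    open ℕP.≤-Reasoning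
    a² : Fin n → ℕ
    a² i = a i * a i
    pointwise : ∀ i j → 2 * (a i * a j) ≤ 𝟙 (g i) * a² j + a² i * 𝟙 (g j)
    pointwise i j with g i in gi | g j in gj
    ... | false | _     rewrite vanish i gi = z≤n
    ... | true  | false rewrite vanish j gj | ℕP.*-zeroʳ (a i) = z≤n
    ... | true  | true  = subst (2 * (a i * a j) ≤_) (both-weights (a i) (a j)) (2mn≤m²+n² (a i) (a j))
      where
      both-weights : ∀ m n → m * m + n * n ≡ 1 * (n * n) + m * m * 1
      both-weights = solve-∀

  sum-diagonal-≤ : ∀ {n} (g : Fin n → Bool) (a : Fin n) (Y : Fin n → ℕ) {D E} →
    g a ≡ true → Y a ≡ D → (∀ i → i ≢ a → Y i ≤ 𝟙 (g i) * E) →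
    sum Y + E ≤ D + count g * E
  sum-diagonal-≤ {n} g a Y {D} {E} ga Ya off = begin
    sum Y + E
      ≡⟨ cong (sum Y +_) (trans (cong (_* E) (count-≟ a)) (ℕP.*-identityˡ E)) ⟨
    sum Y + count δ * E
      ≡⟨ cong (sum Y +_) (sum-𝟙*-const δ (λ _ → E) (λ _ _ → refl)) ⟨
    sum Y + sum (λ i → 𝟙 (δ i) * E)
      ≡⟨ ∑-distrib-+ Y (λ i → 𝟙 (δ i) * E) ⟨
    sum (λ i → Y i + 𝟙 (δ i) * E)
      ≤⟨ sum-mono-≤ pointwise ⟩
    sum (λ i → 𝟙 (δ i) * D + 𝟙 (g i) * E)
      ≡⟨ ∑-distrib-+ (λ i → 𝟙 (δ i) * D) (λ i → 𝟙 (g i) * E) ⟩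
    sum (λ i → 𝟙 (δ i) * D) + sum (λ i → 𝟙 (g i) * E)
      ≡⟨ cong₂ _+_ (sum-𝟙*-const δ (λ _ → D) (λ _ _ → refl)) (sum-𝟙*-const g (λ _ → E) (λ _ _ → refl)) ⟩
    count δ * D + count g * E
      ≡⟨ cong (λ c → c * D + count g * E) (count-≟ a) ⟩
    1 * D + count g * E
      ≡⟨ cong (_+ count g * E) (ℕP.*-identityˡ D) ⟩
    D + count g * E
      ∎
    where
    open ℕP.≤-Reasoning
    δ : Fin n → Bool
    δ i = ⌊ i ≟ a ⌋
    pointwise : ∀ i → Y i + 𝟙 (δ i) * E ≤ 𝟙 (δ i) * D + 𝟙 (g i) * E
    pointwise i with i ≟ a
    ... | yes refl rewrite ga | Ya = ℕP.≤-reflexive (cong (_+ (E + 0)) (sym (ℕP.+-identityʳ D)))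
    ... | no i≢a = subst (_≤ 𝟙 (g i) * E) (sym (ℕP.+-identityʳ (Y i))) (off i i≢a)

module Arithmetic where

  open import Data.Nat using (ℕ; zero; suc; pred; _+_; _*_; _≤_; _<_; z≤n; s≤s; z<s; _≤?_)
  open import Data.Nat.Properties
  open import Data.Fin using (Fin; zero)
  open import Data.Product using (_,_)
  open import Relation.Nullary using (yes; no; contradiction)
  open import Relation.Binary.PropositionalEquality
  open import Data.Nat.Tactic.RingSolver using (solve-∀)

  *-monoʳ-≤-inhabited : ∀ n {a b} → (Fin n → a ≤ b) → n * a ≤ n * b
  *-monoʳ-≤-inhabited zero    _ = z≤n
  *-monoʳ-≤-inhabited (suc n) h = *-monoʳ-≤ (suc n) (h zero)

  private
    ≤-witness : ∀ {m n} (k : ℕ) → m + k ≡ n → m ≤ n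
    ≤-witness {m} k refl = m≤m+n m k

  remaining-neighbours : ∀ s t m c → m + 1 ≡ suc s + suc s → m + c ≡ suc (s * suc t) →
    c ≡ s * pred t
  remaining-neighbours s t m c m+1≡ m+c≡ = shift t c+s≡st
    where
    m≡ : m ≡ suc (s + s)
    m≡ = +-cancelʳ-≡ 1 m _ (trans m+1≡ (twice s))
      where
      twice : ∀ s → suc s + suc s ≡ suc (s + s) + 1
      twice = solve-∀
    c+s≡st : c + s ≡ s * t
    c+s≡st = +-cancelʳ-≡ (suc s) _ _ (begin
      c + s + suc s         ≡⟨ rearrange c s ⟩
      suc (s + s) + c       ≡⟨ cong (_+ c) m≡ ⟨
      m + c                 ≡⟨ m+c≡ ⟩
      suc (s * suc t)       ≡⟨ expand s t ⟩
      s * t + suc s         ∎)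
      where
      open ≡-Reasoning
      rearrange : ∀ c s → c + s + suc s ≡ suc (s + s) + c
      rearrange = solve-∀
      expand : ∀ s t → suc (s * suc t) ≡ s * t + suc s
      expand = solve-∀
    shift : ∀ t → c + s ≡ s * t → c ≡ s * pred t
    shift zero    e = trans (m+n≡0⇒m≡0 c (trans e (*-zeroʳ s))) (sym (*-zeroʳ s))
    shift (suc t) e = +-cancelʳ-≡ s c _ (trans e (trans (*-suc s t) (+-comm s (s * t))))

  higman-arithmetic : ∀ s t v → 2 ≤ s →
    v + 2 * suc (s * suc t) ≡ suc s * suc (s * t) + suc t →
    (suc t * (s * pred t)) * (suc t * (s * pred t)) ≤ v * (suc t * (s * pred t + t * pred t)) →
    t ≤ s * s
  higman-arithmetic s t v 2≤s count-V moments with t ≤? s * s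
  ... | yes t≤s² = t≤s²
  ... | no t≰s² with m≤n⇒∃[o]m+o≡n (≰⇒> t≰s²)
  higman-arithmetic (suc (suc s′)) .(suc (suc (suc s′) * suc (suc s′) + b)) v (s≤s (s≤s _)) count-V moments
    | no _ | b , refl = contradiction (+-cancelˡ-≤ (F * Q) D 0 (begin
      F * Q + D      ≡⟨ excess (suc s′) b ⟨
      P + E * Q      ≤⟨ +-monoˡ-≤ (E * Q) moments ⟩
      v * Q + E * Q  ≡⟨ *-distribʳ-+ Q v E ⟨
      (v + E) * Q    ≡⟨ cong (_* Q) count-V ⟩
      F * Q          ≡⟨ +-identityʳ (F * Q) ⟨
      F * Q + 0      ∎)) λ ()
    where
    open ≤-Reasoning
    s = suc (suc s′)
    m = s * s + b
    t = suc m
    P = (suc t * (s * m)) * (suc t * (s * m))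
    Q = suc t * (s * m + t * m)
    E = 2 * suc (s * suc t)
    F = suc s * suc (s * t) + suc t
    D = suc t * m * t * suc b * suc s′
    -- For t = s² + 1 + b, P exceeds (F − E) * Q = v * Q by D > 0.
    excess : ∀ s₁ b → let s = 1 + s₁; m = s * s + b; t = 1 + m in
      (suc t * (s * m)) * (suc t * (s * m)) + 2 * suc (s * suc t) * (suc t * (s * m + t * m)) ≡
      (suc s * suc (s * t) + suc t) * (suc t * (s * m + t * m)) + suc t * m * t * suc b * s₁
    excess = solve-∀

  K<n : ∀ s t → 1 ≤ s → 1 ≤ t → suc (s * suc t) < suc s * suc (s * t)
  K<n (suc a) (suc b) _ _ =
    subst (suc (s * suc t) <_) (split s t) (m<m+n (suc (s * suc t)) z<s)
    where
    s = suc a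
    t = suc b
    split : ∀ s t → suc (s * suc t) + s * (s * t) ≡ suc s * suc (s * t)
    split = solve-∀

  symmetric-difference-collinear : ∀ s t d → d + (suc s + suc s) ≡ suc (s * suc t) + suc (s * suc t) →
    s * t ≤ d
  symmetric-difference-collinear s t d e =
    subst (s * t ≤_) (sym (+-cancelʳ-≡ (suc s + suc s) d _ (trans e (double s t)))) (m≤m+n (s * t) (s * t))
    where
    double : ∀ s t → suc (s * suc t) + suc (s * suc t) ≡ s * t + s * t + (suc s + suc s)
    double = solve-∀

  symmetric-difference-noncollinear : ∀ s t d → 2 ≤ s →
    d + (suc t + suc t) ≡ suc (s * suc t) + suc (s * suc t) → s * t ≤ d
  symmetric-difference-noncollinear s t d 2≤s e = +-cancelʳ-≤ (suc t + suc t) (s * t) d (begin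
    s * t + (suc t + suc t)   ≡⟨ regroup s t ⟩
    s * t + 2 * t + 2         ≤⟨ +-monoˡ-≤ 2 (+-monoʳ-≤ (s * t) (*-monoˡ-≤ t 2≤s)) ⟩
    s * t + s * t + 2         ≤⟨ ≤-witness (s + s) (extra s t) ⟩
    suc (s * suc t) + suc (s * suc t) ≡⟨ e ⟨
    d + (suc t + suc t)       ∎)
    where
    open ≤-Reasoning
    regroup : ∀ s t → s * t + (suc t + suc t) ≡ s * t + 2 * t + 2
    regroup = solve-∀
    extra : ∀ s t → s * t + s * t + 2 + (s + s) ≡ suc (s * suc t) + suc (s * suc t)
    extra = solve-∀

  private
    ^3-mono : ∀ {a b} → a ≤ b → a * a * a ≤ b * b * b
    ^3-mono a≤b = *-mono-≤ (*-mono-≤ a≤b a≤b) a≤b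

  K⁴≤32n³ : ∀ s t → 1 ≤ t → t ≤ s * s →
    let K = suc (s * suc t); n = suc s * suc (s * t) in K * K * K * K ≤ 32 * (n * n * n)
  K⁴≤32n³ s t 1≤t t≤s² = begin
    K * K * K * K                  ≤⟨ *-mono-≤ (^3-mono K≤2q) K≤2q ⟩
    2 * q * (2 * q) * (2 * q) * (2 * q) ≡⟨ sixteen q ⟩
    16 * (q * q * q * q)           ≤⟨ *-monoʳ-≤ 16 (*-monoʳ-≤ (q * q * q) q≤c³) ⟩
    16 * (q * q * q * (c * c * c)) ≤⟨ *-monoˡ-≤ (q * q * q * (c * c * c)) (≤-witness {16} {32} 16 refl) ⟩
    32 * (q * q * q * (c * c * c)) ≡⟨ cong (32 *_) (regroup q c) ⟩
    32 * (c * q * (c * q) * (c * q)) ∎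
    where
    open ≤-Reasoning
    K = suc (s * suc t)
    q = suc (s * t)
    c = suc s
    K≤2q : K ≤ 2 * q
    K≤2q = begin
      suc (s * suc t)       ≡⟨ cong suc (*-suc s t) ⟩
      suc (s + s * t)       ≤⟨ s≤s (+-monoˡ-≤ (s * t) s≤st) ⟩
      suc (s * t + s * t)   ≤⟨ ≤-witness 1 (double (s * t)) ⟩
      2 * q                 ∎
      where
      s≤st : s ≤ s * t
      s≤st = subst (_≤ s * t) (*-identityʳ s) (*-monoʳ-≤ s 1≤t)
      double : ∀ m → suc (m + m) + 1 ≡ 2 * suc m
      double = solve-∀
    q≤c³ : q ≤ c * c * c
    q≤c³ = ≤-trans (s≤s (*-monoʳ-≤ s t≤s²)) (≤-witness (3 * (s * s) + 3 * s) (cube s))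
      where
      cube : ∀ s → suc (s * (s * s)) + (3 * (s * s) + 3 * s) ≡ suc s * suc s * suc s
      cube = solve-∀
    sixteen : ∀ q → 2 * q * (2 * q) * (2 * q) * (2 * q) ≡ 16 * (q * q * q * q)
    sixteen = solve-∀
    regroup : ∀ q c → q * q * q * (c * c * c) ≡ c * q * (c * q) * (c * q)
    regroup = solve-∀

  n³≤32[st]⁵ : ∀ s t → 2 ≤ s → 2 ≤ t → s ≤ t * t →
    let n = suc s * suc (s * t); M = s * t in n * n * n ≤ 32 * (M * M * M * M * M)
  n³≤32[st]⁵ s t 2≤s 2≤t s≤t² = *-cancelˡ-≤ 512 (begin
    512 * (c * q * (c * q) * (c * q))
      ≡⟨ scale c q ⟩
    2 * c * (2 * c) * (2 * c) * (4 * q * (4 * q) * (4 * q))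
      ≤⟨ *-mono-≤ (^3-mono 2c≤3s) (^3-mono 4q≤5M) ⟩
    3 * s * (3 * s) * (3 * s) * (5 * M * (5 * M) * (5 * M))
      ≡⟨ expand s t ⟩
    3375 * (s⁵t³ * s)
      ≤⟨ *-monoʳ-≤ 3375 (*-monoʳ-≤ s⁵t³ s≤t²) ⟩
    3375 * (s⁵t³ * (t * t))
      ≤⟨ *-monoˡ-≤ (s⁵t³ * (t * t)) (≤-witness {3375} {16384} 13009 refl) ⟩
    16384 * (s⁵t³ * (t * t))
      ≡⟨ collect s t ⟩
    512 * (32 * (M * M * M * M * M))
      ∎)
    where
    open ≤-Reasoning
    c = suc s
    q = suc (s * t)
    M = s * t
    s⁵t³ = s * s * s * s * s * (t * t * t)
    2c≤3s : 2 * c ≤ 3 * s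
    2c≤3s = subst₂ _≤_ (two s) (three s) (+-monoˡ-≤ (2 * s) 2≤s)
      where
      two : ∀ s → 2 + 2 * s ≡ 2 * suc s
      two = solve-∀
      three : ∀ s → s + 2 * s ≡ 3 * s
      three = solve-∀
    4q≤5M : 4 * q ≤ 5 * M
    4q≤5M = subst₂ _≤_ (four M) (five M) (+-monoˡ-≤ (4 * M) (*-mono-≤ 2≤s 2≤t))
      where
      four : ∀ m → 4 + 4 * m ≡ 4 * suc m
      four = solve-∀
      five : ∀ m → m + 4 * m ≡ 5 * m
      five = solve-∀
    scale : ∀ c q → 512 * (c * q * (c * q) * (c * q)) ≡ 2 * c * (2 * c) * (2 * c) * (4 * q * (4 * q) * (4 * q))
    scale = solve-∀
    expand : ∀ s t → 3 * s * (3 * s) * (3 * s) * (5 * (s * t) * (5 * (s * t)) * (5 * (s * t))) ≡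
                     3375 * (s * s * s * s * s * (t * t * t) * s)
    expand = solve-∀
    collect : ∀ s t → 16384 * (s * s * s * s * s * (t * t * t) * (t * t)) ≡
                      512 * (32 * (s * t * (s * t) * (s * t) * (s * t) * (s * t)))
    collect = solve-∀


module GQProperties {s t : ℕ} (Γ : GQ s t) where

  open import Data.Nat using (suc; pred; _+_; _*_; _≤_; z<s)
  import Data.Nat.Properties as ℕP
  open import Data.Fin using (_≟_)
  open import Data.Bool using (Bool; true; false; _∧_; _∨_; not; _xor_)
  open import Data.Bool.Properties
    using (¬-not; not-involutive; ∨-zeroʳ; ∧-conicalˡ; ∧-conicalʳ; ∧-idem; ∧-zeroʳ; ∧-identityʳ;
           ∧-comm; ∧-distribˡ-∨)
  open import Data.Product using (_,_; ∃-syntax; proj₁; proj₂)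
  open import Function using (_∘_)
  open import Relation.Nullary using (contradiction)
  open import Relation.Nullary.Decidable using (⌊_⌋; yes; no)
  open import Relation.Binary.PropositionalEquality
  open import Data.Nat.Tactic.RingSolver using (solve-∀)
  open import Algebra.Properties.Semiring.Sum ℕP.+-*-semiring
    using (sum; sum-cong-≗; ∑-distrib-+; sum-replicate-zero)
  open Counting
  open GQ Γ

  N[_] : Fin p → Fin p → Bool
  N[ u ] = inN Γ u

  Collinear : Fin p → Fin p → Set
  Collinear u w = ∃[ L ] (I u L ≡ true × I w L ≡ true)

  line-through : ∀ u → ∃[ L ] I u L ≡ true
  line-through u = count>0⇒∃ (I u) (subst (0 <_) (sym (ptLines u)) z<s)

  collinear⇒∈N : ∀ {u w} → Collinear u w → N[ u ] w ≡ true
  collinear⇒∈N {u} {w} (L , uL , wL) with ⌊ u ≟ w ⌋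
  ... | true  = refl
  ... | false = anyF-intro (λ L → I u L ∧ I w L) L (cong₂ _∧_ uL wL)

  ∈N⇒collinear : ∀ {u w} → N[ u ] w ≡ true → Collinear u w
  ∈N⇒collinear {u} {w} e with u ≟ w
  ... | yes refl = let L , uL = line-through u in L , uL , uL
  ... | no _     = let L , uwL = anyF-elim (λ L → I u L ∧ I w L) e in
                   L , ∧-conicalˡ _ _ uwL , ∧-conicalʳ _ _ uwL

  ∈N-refl : ∀ u → N[ u ] u ≡ true
  ∈N-refl u = let L , uL = line-through u in collinear⇒∈N (L , uL , uL)

  ∈N-sym : ∀ {u w} → N[ u ] w ≡ true → N[ w ] u ≡ true
  ∈N-sym uw = let L , uL , wL = ∈N⇒collinear uw in collinear⇒∈N (L , wL , uL)

  N-sym : ∀ u w → N[ u ] w ≡ N[ w ] u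
  N-sym u w = ≡-by-true ∈N-sym ∈N-sym

  ∉N⇒off-line : ∀ {u w L} → N[ u ] w ≡ false → I u L ≡ true → I w L ≡ false
  ∉N⇒off-line uw uL = ¬-not λ wL → contradiction (trans (sym uw) (collinear⇒∈N (_ , uL , wL))) λ ()

  commonLines : Fin p → Fin p → ℕ
  commonLines u w = count (λ L → I u L ∧ I w L)

  commonLines-self : ∀ u → commonLines u u ≡ suc t
  commonLines-self u = trans (count-cong (λ L → ∧-idem (I u L))) (ptLines u)

  commonLines-distinct : ∀ {u w} → u ≢ w → commonLines u w ≡ 𝟙 (N[ u ] w)
  commonLines-distinct {u} {w} u≢w with N[ u ] w in uw
  ... | true  = let L , uL , wL = ∈N⇒collinear uw in
    count≡1 _ L (cong₂ _∧_ uL wL)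
      (λ M uwM → sym (partialLinear u w L M u≢w uL wL (∧-conicalˡ _ _ uwM) (∧-conicalʳ _ _ uwM)))
  ... | false = count-false (λ L → ¬-not λ uwL →
    contradiction (trans (sym uw) (collinear⇒∈N (L , ∧-conicalˡ _ _ uwL , ∧-conicalʳ _ _ uwL))) λ ())

  neighbour-on-line : ∀ {z M} → I z M ≡ false → ∃[ a ] (I a M ≡ true × N[ z ] a ≡ true)
  neighbour-on-line zM =
    let M₀ , (zM₀ , a , aM₀ , aM) , _ = gqAxiom _ _ zM in a , aM , collinear⇒∈N (M₀ , zM₀ , aM₀)

  neighbour-on-line-unique : ∀ {z M a b} → I z M ≡ false → I a M ≡ true → I b M ≡ true →
    N[ z ] a ≡ true → N[ z ] b ≡ true → a ≡ b
  neighbour-on-line-unique {z} {M} {a} {b} zM aM bM za zb with a ≟ b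
  ... | yes a≡b = a≡b
  ... | no a≢b  =
    let M₀ , _ , unique = gqAxiom z M zM
        L₁ , zL₁ , aL₁ = ∈N⇒collinear za
        L₂ , zL₂ , bL₂ = ∈N⇒collinear zb
        L₁≡M₀ = unique L₁ zL₁ (a , aL₁ , aM)
        L₂≡M₀ = unique L₂ zL₂ (b , bL₂ , bM)
        M₀≡M = partialLinear a b M₀ M a≢b (subst (λ L → I a L ≡ true) L₁≡M₀ aL₁)
                 (subst (λ L → I b L ≡ true) L₂≡M₀ bL₂) aM bM
    in contradiction (trans (sym zM) (subst (λ L → I z L ≡ true) (trans L₁≡M₀ M₀≡M) zL₁)) λ ()

  neighbours-on-line : ∀ {z M} → I z M ≡ false → count (λ a → I a M ∧ N[ z ] a) ≡ 1
  neighbours-on-line zM = let a , aM , za = neighbour-on-line zM in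
    count≡1 _ a (cong₂ _∧_ aM za)
      (λ b bMz → neighbour-on-line-unique zM (∧-conicalˡ _ _ bMz) aM (∧-conicalʳ _ _ bMz) za)

  ∈N-both⇒on-line : ∀ {u v M z} → u ≢ v → I u M ≡ true → I v M ≡ true →
    N[ u ] z ≡ true → N[ v ] z ≡ true → I z M ≡ true
  ∈N-both⇒on-line {u} {v} {M} {z} u≢v uM vM uz vz with I z M in zM
  ... | true  = refl
  ... | false = contradiction (neighbour-on-line-unique zM uM vM (∈N-sym uz) (∈N-sym vz)) u≢v

  N-size : ∀ u → count N[ u ] ≡ suc (s * suc t)
  N-size u = ℕP.+-cancelʳ-≡ t _ _ (begin
    count N[ u ] + t
      ≡⟨ cong (count N[ u ] +_) (trans (cong (_* t) (count-≟ u)) (ℕP.*-identityˡ t)) ⟨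
    count N[ u ] + count δ * t
      ≡⟨ cong₂ _+_ (sym (count-sum N[ u ])) (sum-𝟙*-const δ (λ _ → t) (λ _ _ → refl)) ⟨
    sum (𝟙 ∘ N[ u ]) + sum (λ w → 𝟙 (δ w) * t)
      ≡⟨ ∑-distrib-+ (𝟙 ∘ N[ u ]) (λ w → 𝟙 (δ w) * t) ⟨
    sum (λ w → 𝟙 (N[ u ] w) + 𝟙 (δ w) * t)
      ≡⟨ sum-cong-≗ pointwise ⟨
    sum (commonLines u)
      ≡⟨ double-count (I u) (λ w L → I w L) (λ L _ → linePts L) ⟩
    count (I u) * suc s
      ≡⟨ cong (_* suc s) (ptLines u) ⟩
    suc t * suc s
      ≡⟨ flags s t ⟩
    suc (s * suc t) + t
      ∎)
    where
    open ≡-Reasoning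
    δ : Fin p → Bool
    δ w = ⌊ w ≟ u ⌋
    pointwise : ∀ w → commonLines u w ≡ 𝟙 (N[ u ] w) + 𝟙 (δ w) * t
    pointwise w with w ≟ u
    ... | yes refl rewrite ∈N-refl w = trans (commonLines-self w) (cong suc (sym (ℕP.+-identityʳ t)))
    ... | no w≢u   = trans (commonLines-distinct (w≢u ∘ sym)) (sym (ℕP.+-identityʳ _))
    flags : ∀ s t → suc t * suc s ≡ suc (s * suc t) + t
    flags = solve-∀

  point-count : Fin l → p ≡ suc s * suc (s * t)
  point-count L = ℕP.+-cancelʳ-≡ (suc s * s) _ _ (begin
    p + suc s * s
      ≡⟨ cong₂ _+_ (count-true p) (cong (_* s) (linePts L)) ⟨
    count {p} (λ _ → true) + count (λ z → I z L) * s
      ≡⟨ cong₂ _+_ (sym (count-sum {p} (λ _ → true))) (sum-𝟙*-const (λ z → I z L) (λ _ → s) (λ _ _ → refl)) ⟨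
    sum {p} (λ _ → 1) + sum (λ z → 𝟙 (I z L) * s)
      ≡⟨ ∑-distrib-+ {p} (λ _ → 1) (λ z → 𝟙 (I z L) * s) ⟨
    sum (λ z → 1 + 𝟙 (I z L) * s)
      ≡⟨ sum-cong-≗ neighbours-on-L ⟨
    sum (λ z → count (λ a → I a L ∧ N[ z ] a))
      ≡⟨ double-count (λ a → I a L) (λ z a → N[ z ] a)
           (λ a _ → trans (count-cong (λ z → N-sym z a)) (N-size a)) ⟩
    count (λ a → I a L) * suc (s * suc t)
      ≡⟨ cong (_* suc (s * suc t)) (linePts L) ⟩
    suc s * suc (s * suc t)
      ≡⟨ pairs s t ⟩
    suc s * suc (s * t) + suc s * s
      ∎)
    where
    open ≡-Reasoning
    neighbours-on-L : ∀ z → count (λ a → I a L ∧ N[ z ] a) ≡ 1 + 𝟙 (I z L) * s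
    neighbours-on-L z with I z L in zL
    ... | true  = trans (count-cong {p} (λ a → ≡-by-true (∧-conicalˡ (I a L) _)
                                        (λ aL → cong₂ _∧_ aL (collinear⇒∈N (L , zL , aL)))))
                        (trans (linePts L) (cong suc (sym (ℕP.+-identityʳ s))))
    ... | false = neighbours-on-line zL
    pairs : ∀ s t → suc s * suc (s * suc t) ≡ suc s * suc (s * t) + suc s * s
    pairs = solve-∀

  commonNeighbours : Fin p → Fin p → ℕ
  commonNeighbours u v = count (λ z → N[ u ] z ∧ N[ v ] z)

  commonNeighbours-collinear : ∀ {u v M} → u ≢ v → I u M ≡ true → I v M ≡ true →
    commonNeighbours u v ≡ suc s
  commonNeighbours-collinear {u} {v} {M} u≢v uM vM = trans (count-cong on-M) (linePts M)
    where
    on-M : ∀ z → (N[ u ] z ∧ N[ v ] z) ≡ I z M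
    on-M z = ≡-by-true
      (λ uvz → ∈N-both⇒on-line u≢v uM vM (∧-conicalˡ _ _ uvz) (∧-conicalʳ _ _ uvz))
      (λ zM → cong₂ _∧_ (collinear⇒∈N (M , uM , zM)) (collinear⇒∈N (M , vM , zM)))

  commonNeighbours-noncollinear : ∀ {u v} → N[ u ] v ≡ false → commonNeighbours u v ≡ suc t
  commonNeighbours-noncollinear {u} {v} uv = begin
    count (λ z → N[ u ] z ∧ N[ v ] z)
      ≡⟨ count-sum (λ z → N[ u ] z ∧ N[ v ] z) ⟩
    sum (λ z → 𝟙 (N[ u ] z ∧ N[ v ] z))
      ≡⟨ sum-cong-≗ via-lines ⟩
    sum (λ z → count (λ L → I u L ∧ (I z L ∧ N[ v ] z)))
      ≡⟨ double-count (I u) (λ z L → I z L ∧ N[ v ] z)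
           (λ L uL → neighbours-on-line (∉N⇒off-line uv uL)) ⟩
    count (I u) * 1
      ≡⟨ trans (ℕP.*-identityʳ _) (ptLines u) ⟩
    suc t
      ∎
    where
    open ≡-Reasoning
    via-lines : ∀ z → 𝟙 (N[ u ] z ∧ N[ v ] z) ≡ count (λ L → I u L ∧ (I z L ∧ N[ v ] z))
    via-lines z with N[ v ] z in vz | z ≟ u
    ... | false | _ rewrite ∧-zeroʳ (N[ u ] z) =
      sym (count-false (λ L → trans (cong (I u L ∧_) (∧-zeroʳ (I z L))) (∧-zeroʳ (I u L))))
    ... | true | yes refl = contradiction (trans (sym uv) (∈N-sym vz)) λ ()
    ... | true | no z≢u = begin
      𝟙 (N[ u ] z ∧ true)                    ≡⟨ cong 𝟙 (∧-identityʳ _) ⟩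
      𝟙 (N[ u ] z)                           ≡⟨ commonLines-distinct (z≢u ∘ sym) ⟨
      commonLines u z                        ≡⟨ count-cong (λ L → cong (I u L ∧_) (sym (∧-identityʳ _))) ⟩
      count (λ L → I u L ∧ (I z L ∧ true))   ∎

  module Higman {x y : Fin p} (xy : N[ x ] y ≡ false) where

    W A V : Fin p → Bool
    W u = N[ x ] u ∧ N[ y ] u
    A z = N[ x ] z ∨ N[ y ] z
    V z = not (A z)

    x≢y : x ≢ y
    x≢y refl = contradiction (trans (sym xy) (∈N-refl x)) λ ()

    count-W : count W ≡ suc t
    count-W = commonNeighbours-noncollinear xy

    count-V : count V + 2 * suc (s * suc t) ≡ p + suc t
    count-V = begin
      count V + 2 * K
        ≡⟨ cong (λ k → count V + (K + k)) (ℕP.+-identityʳ K) ⟩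
      count V + (K + K)
        ≡⟨ cong₂ (λ a b → count V + (a + b)) (N-size x) (N-size y) ⟨
      count V + (count N[ x ] + count N[ y ])
        ≡⟨ cong (count V +_) (count-∨-∧ N[ x ] N[ y ]) ⟨
      count V + (count A + count W)
        ≡⟨ rearrange (count V) (count A) (count W) ⟩
      (count A + count V) + count W
        ≡⟨ cong₂ _+_ (count-not A) count-W ⟩
      p + suc t
        ∎
      where
      open ≡-Reasoning
      K = suc (s * suc t)
      rearrange : ∀ v a w → v + (a + w) ≡ a + v + w
      rearrange = solve-∀

    module _ {u : Fin p} (Wu : W u ≡ true) where

      private
        xu : N[ x ] u ≡ true
        xu = ∧-conicalˡ _ _ Wu
        yu : N[ y ] u ≡ true
        yu = ∧-conicalʳ _ _ Wu
        u≢x : u ≢ x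
        u≢x refl = contradiction (trans (sym xy) (∈N-sym yu)) λ ()
        u≢y : u ≢ y
        u≢y refl = contradiction (trans (sym xy) xu) λ ()
        Mx = proj₁ (∈N⇒collinear xu)
        xMx : I x Mx ≡ true
        xMx = proj₁ (proj₂ (∈N⇒collinear xu))
        uMx : I u Mx ≡ true
        uMx = proj₂ (proj₂ (∈N⇒collinear xu))
        My = proj₁ (∈N⇒collinear yu)
        yMy : I y My ≡ true
        yMy = proj₁ (proj₂ (∈N⇒collinear yu))
        uMy : I u My ≡ true
        uMy = proj₂ (proj₂ (∈N⇒collinear yu))

      only-common-neighbour : ∀ {z} → N[ u ] z ≡ true → N[ x ] z ≡ true → N[ y ] z ≡ true → z ≡ u
      only-common-neighbour uz xz yz =
        neighbour-on-line-unique (∉N⇒off-line xy xMx) (∈N-both⇒on-line u≢x uMx xMx uz xz) uMx yz yu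

      V-neighbours : count (λ z → V z ∧ N[ u ] z) ≡ s * pred t
      V-neighbours = Arithmetic.remaining-neighbours s t _ _ neighbours-in-A partition
        where
        open ≡-Reasoning
        Nx Ny : Fin p → Bool
        Nx z = N[ u ] z ∧ N[ x ] z
        Ny z = N[ u ] z ∧ N[ y ] z
        only-u : count (λ z → Nx z ∧ Ny z) ≡ 1
        only-u = count≡1 _ u (cong₂ _∧_ (cong₂ _∧_ (∈N-refl u) xu) (cong₂ _∧_ (∈N-refl u) yu)) λ z h →
          let uxz = ∧-conicalˡ (Nx z) (Ny z) h in
          only-common-neighbour (∧-conicalˡ _ _ uxz) (∧-conicalʳ _ _ uxz)
            (∧-conicalʳ _ _ (∧-conicalʳ (Nx z) _ h))
        neighbours-in-A : count (λ z → N[ u ] z ∧ A z) + 1 ≡ suc s + suc s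
        neighbours-in-A = begin
          count (λ z → N[ u ] z ∧ A z) + 1
            ≡⟨ cong₂ _+_ (count-cong (λ z → sym (∧-distribˡ-∨ (N[ u ] z) (N[ x ] z) (N[ y ] z)))) only-u ⟨
          count (λ z → Nx z ∨ Ny z) + count (λ z → Nx z ∧ Ny z)
            ≡⟨ count-∨-∧ Nx Ny ⟩
          commonNeighbours u x + commonNeighbours u y
            ≡⟨ cong₂ _+_ (commonNeighbours-collinear u≢x uMx xMx) (commonNeighbours-collinear u≢y uMy yMy) ⟩
          suc s + suc s
            ∎
        partition : count (λ z → N[ u ] z ∧ A z) + count (λ z → V z ∧ N[ u ] z) ≡ suc (s * suc t)
        partition = trans (cong (count (λ z → N[ u ] z ∧ A z) +_) (count-cong (λ z → ∧-comm (V z) (N[ u ] z))))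
                          (trans (count-∧-∧¬ N[ u ] A) (N-size u))

      W-noncollinear : ∀ {u′} → W u′ ≡ true → u ≢ u′ → N[ u ] u′ ≡ false
      W-noncollinear Wu′ u≢u′ = ¬-not λ uu′ →
        u≢u′ (sym (only-common-neighbour uu′ (∧-conicalˡ _ _ Wu′) (∧-conicalʳ _ _ Wu′)))

      common-V-neighbours : ∀ {u′} → W u′ ≡ true → u ≢ u′ →
        count (λ z → (N[ u ] z ∧ N[ u′ ] z) ∧ V z) ≤ pred t
      common-V-neighbours {u′} Wu′ u≢u′ = ℕP.<⇒≤pred (ℕ.s≤s⁻¹ (begin
        2 + count (λ z → C z ∧ V z)
          ≤⟨ ℕP.+-monoˡ-≤ _ (count≥2 (λ z → C z ∧ not (V z)) x≢y
               (in-C-not-V xu (∧-conicalˡ _ _ Wu′) x∈A) (in-C-not-V yu (∧-conicalʳ _ _ Wu′) y∈A)) ⟩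
        count (λ z → C z ∧ not (V z)) + count (λ z → C z ∧ V z)
          ≡⟨ ℕP.+-comm (count (λ z → C z ∧ not (V z))) _ ⟩
        count (λ z → C z ∧ V z) + count (λ z → C z ∧ not (V z))
          ≡⟨ count-∧-∧¬ C V ⟩
        commonNeighbours u u′
          ≡⟨ commonNeighbours-noncollinear (W-noncollinear Wu′ u≢u′) ⟩
        suc t
          ∎))
        where
        open ℕP.≤-Reasoning
        C : Fin p → Bool
        C z = N[ u ] z ∧ N[ u′ ] z
        in-C-not-V : ∀ {w} → N[ w ] u ≡ true → N[ w ] u′ ≡ true → A w ≡ true → C w ∧ not (V w) ≡ true
        in-C-not-V {w} wu wu′ Aw = cong₂ _∧_ (cong₂ _∧_ (∈N-sym wu) (∈N-sym wu′)) (trans (not-involutive (A w)) Aw)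
        x∈A : A x ≡ true
        x∈A = cong (_∨ N[ y ] x) (∈N-refl x)
        y∈A : A y ≡ true
        y∈A = trans (cong (N[ x ] y ∨_) (∈N-refl y)) (∨-zeroʳ _)

    edge : Fin p → Fin p → Bool
    edge z u = W u ∧ (V z ∧ N[ u ] z)

    edge-vanishes : ∀ z → V z ≡ false → count (edge z) ≡ 0
    edge-vanishes z Vz = count-false λ u → trans (cong (λ b → W u ∧ (b ∧ N[ u ] z)) Vz) (∧-zeroʳ (W u))

    first-moment : sum (λ z → count (edge z)) ≡ suc t * (s * pred t)
    first-moment = trans (double-count W (λ z u → V z ∧ N[ u ] z) (λ _ Wu → V-neighbours Wu))
                         (cong (_* (s * pred t)) count-W)

    row-bound : ∀ u → sum (λ u′ → count (λ z → edge z u ∧ edge z u′)) ≤ 𝟙 (W u) * (s * pred t + t * pred t)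
    row-bound u = ≤-𝟙* (W u) present absent
      where
      Y : Fin p → ℕ
      Y u′ = count (λ z → edge z u ∧ edge z u′)
      absent : W u ≡ false → sum Y ≡ 0
      absent Wu = trans (sum-cong-≗ λ u′ → count-false λ z → cong (λ b → (b ∧ (V z ∧ N[ u ] z)) ∧ edge z u′) Wu)
                        (sum-replicate-zero p)
      present : W u ≡ true → sum Y ≤ s * pred t + t * pred t
      present Wu = ℕP.+-cancelʳ-≤ (pred t) _ _ (begin
        sum Y + pred t                   ≤⟨ sum-diagonal-≤ W u Y Wu diagonal off-diagonal ⟩
        s * pred t + count W * pred t    ≡⟨ cong (λ w → s * pred t + w * pred t) count-W ⟩
        s * pred t + suc t * pred t      ≡⟨ cong (s * pred t +_) (ℕP.+-comm (pred t) (t * pred t)) ⟩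
        s * pred t + (t * pred t + pred t) ≡⟨ ℕP.+-assoc (s * pred t) (t * pred t) (pred t) ⟨
        s * pred t + t * pred t + pred t ∎)
        where
        open ℕP.≤-Reasoning
        diagonal : Y u ≡ s * pred t
        diagonal = trans (count-cong λ z → trans (∧-idem (edge z u)) (cong (_∧ (V z ∧ N[ u ] z)) Wu))
                         (V-neighbours Wu)
        off-diagonal : ∀ u′ → u′ ≢ u → Y u′ ≤ 𝟙 (W u′) * pred t
        off-diagonal u′ u′≢u = ≤-𝟙* (W u′)
          (λ Wu′ → ℕP.≤-trans (count-mono in-C-and-V) (common-V-neighbours Wu Wu′ (u′≢u ∘ sym)))
          (λ Wu′ → count-false λ z →
             trans (cong (λ b → edge z u ∧ (b ∧ (V z ∧ N[ u′ ] z))) Wu′) (∧-zeroʳ (edge z u)))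
          where
          in-C-and-V : ∀ z → edge z u ∧ edge z u′ ≡ true → (N[ u ] z ∧ N[ u′ ] z) ∧ V z ≡ true
          in-C-and-V z h =
            let Vu = ∧-conicalʳ (W u) (V z ∧ N[ u ] z) (∧-conicalˡ _ _ h)
                Vu′ = ∧-conicalʳ (W u′) (V z ∧ N[ u′ ] z) (∧-conicalʳ (edge z u) _ h)
            in cong₂ _∧_ (cong₂ _∧_ (∧-conicalʳ (V z) _ Vu) (∧-conicalʳ (V z) _ Vu′)) (∧-conicalˡ _ _ Vu)

    second-moment : sum (λ z → count (edge z) * count (edge z)) ≤ suc t * (s * pred t + t * pred t)
    second-moment = begin
      sum (λ z → count (edge z) * count (edge z))                  ≡⟨ sum-count² edge ⟩
      sum (λ u → sum (λ u′ → count (λ z → edge z u ∧ edge z u′)))  ≤⟨ sum-mono-≤ row-bound ⟩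
      sum (λ u → 𝟙 (W u) * B)                                    ≡⟨ sum-𝟙*-const W (λ _ → B) (λ _ _ → refl) ⟩
      count W * B                                                ≡⟨ cong (_* B) count-W ⟩
      suc t * B                                                  ∎
      where
      open ℕP.≤-Reasoning
      B = s * pred t + t * pred t

    variance-inequality : (suc t * (s * pred t)) * (suc t * (s * pred t)) ≤
                          count V * (suc t * (s * pred t + t * pred t))
    variance-inequality = begin
      (suc t * (s * pred t)) * (suc t * (s * pred t))      ≡⟨ cong₂ _*_ first-moment first-moment ⟨
      sum (λ z → count (edge z)) * sum (λ z → count (edge z)) ≤⟨ cauchy-schwarz V (count ∘ edge) edge-vanishes ⟩
      count V * sum (λ z → count (edge z) * count (edge z))   ≤⟨ ℕP.*-monoʳ-≤ (count V) second-moment ⟩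
      count V * (suc t * (s * pred t + t * pred t))         ∎
      where open ℕP.≤-Reasoning

  higman : 2 ≤ s → 1 ≤ t → Fin p → t ≤ s * s
  higman 2≤s 1≤t x = Arithmetic.higman-arithmetic s t (count V) 2≤s
    (trans count-V (cong (_+ suc t) (point-count L))) variance-inequality
    where
    L = proj₁ (line-through x)
    N[x]<p : count N[ x ] < p
    N[x]<p = subst₂ _<_ (sym (N-size x)) (sym (point-count L))
               (Arithmetic.K<n s t (ℕP.<⇒≤ 2≤s) 1≤t)
    open Higman (proj₂ (count<n⇒∃ N[ x ] N[x]<p))

  symmetric-difference+common : ∀ u v →
    count (λ w → N[ u ] w xor N[ v ] w) + (commonNeighbours u v + commonNeighbours u v) ≡
    suc (s * suc t) + suc (s * suc t)
  symmetric-difference+common u v = begin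
    count (λ w → N[ u ] w xor N[ v ] w) + (c + c)
      ≡⟨ ℕP.+-assoc _ c c ⟨
    count (λ w → N[ u ] w xor N[ v ] w) + c + c
      ≡⟨ cong (_+ c) (count-xor-∧ N[ u ] N[ v ]) ⟩
    count (λ w → N[ u ] w ∨ N[ v ] w) + c
      ≡⟨ count-∨-∧ N[ u ] N[ v ] ⟩
    count N[ u ] + count N[ v ]
      ≡⟨ cong₂ _+_ (N-size u) (N-size v) ⟩
    suc (s * suc t) + suc (s * suc t)
      ∎
    where
    open ≡-Reasoning
    c = commonNeighbours u v

  st≤symmetric-difference : 2 ≤ s → ∀ {u v} → u ≢ v → s * t ≤ count (λ w → N[ u ] w xor N[ v ] w)
  st≤symmetric-difference 2≤s {u} {v} u≢v = bound
    where
    Δ = count (λ w → N[ u ] w xor N[ v ] w)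
    bound : s * t ≤ Δ
    bound with N[ u ] v in uv
    ... | true  = let L , uL , vL = ∈N⇒collinear uv in
      Arithmetic.symmetric-difference-collinear s t Δ
        (trans (cong (λ c → Δ + (c + c)) (sym (commonNeighbours-collinear u≢v uL vL)))
               (symmetric-difference+common u v))
    ... | false = Arithmetic.symmetric-difference-noncollinear s t Δ 2≤s
        (trans (cong (λ c → Δ + (c + c)) (sym (commonNeighbours-noncollinear uv)))
               (symmetric-difference+common u v))


module Duality where

  open import Data.Nat using (_≤_; _*_)
  open import Data.Bool using (true)
  open import Data.Fin using (_≟_)
  open import Data.Product using (_,_; proj₁)
  open import Relation.Nullary using (contradiction)
  open import Relation.Nullary.Decidable using (yes; no)
  open import Relation.Binary.PropositionalEquality

  dual : ∀ {s t} → GQ s t → GQ t s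
  dual Γ = record
    { p             = l
    ; l             = p
    ; I             = λ L P → I P L
    ; linePts       = ptLines
    ; ptLines       = linePts
    ; partialLinear = lines-meet-once
    ; gqAxiom       = λ L P PL →
        let a , aL , Pa = neighbour-on-line PL
            M , PM , aM = ∈N⇒collinear Pa
        in a , (aL , M , aM , PM) , λ b bL (M′ , bM′ , PM′) →
             neighbour-on-line-unique PL bL aL (collinear⇒∈N (M′ , PM′ , bM′)) Pa
    }
    where
    open GQ Γ
    open GQProperties Γ
    lines-meet-once : ∀ (L M : Fin l) (P Q : Fin p) → L ≢ M →
      I P L ≡ true → I P M ≡ true → I Q L ≡ true → I Q M ≡ true → P ≡ Q
    lines-meet-once L M P Q L≢M PL PM QL QM with P ≟ Q
    ... | yes P≡Q = P≡Q
    ... | no P≢Q  = contradiction (partialLinear P Q L M P≢Q PL QL PM QM) L≢M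

  dual-higman : ∀ {s t} (Γ : GQ s t) → 2 ≤ t → 1 ≤ s → Fin (GQ.p Γ) → s ≤ t * t
  dual-higman Γ 2≤t 1≤s x = GQProperties.higman (dual Γ) 2≤t 1≤s (proj₁ (GQProperties.line-through Γ x))


module RationalSums where

  open import Data.Nat using (zero; suc)
  import Data.Nat.Properties as ℕP
  open import Data.Integer as ℤ using (+_)
  import Data.Integer.Properties as ℤP
  open import Data.Rational using (0ℚ; _+_; _*_; _≤_; nonNegative)
  open import Data.Rational.Properties
  import Data.Rational.Unnormalised as ℚᵘ
  import Data.Rational.Unnormalised.Properties as ℚᵘP
  open import Data.Fin using (zero; suc)
  open import Data.Bool using (Bool; true; false; if_then_else_)
  open import Function using (_∘_)
  open import Relation.Binary.PropositionalEquality
  open import Algebra.Bundles using (CommutativeRing)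
  import Algebra.Properties.Semiring.Sum as Sum
  open import Data.Integer.Tactic.RingSolver using (solve-∀)
  open Counting using (𝟙)

  private
    ℕtoℚᵘ : ∀ n → ℚ.toℚᵘ (ℕtoℚ n) ℚᵘ.≃ ℚᵘ.mkℚᵘ (+ n) 0
    ℕtoℚᵘ n = toℚᵘ-fromℚᵘ (ℚᵘ.mkℚᵘ (+ n) 0)

  ℕtoℚ-+ : ∀ a b → ℕtoℚ (a ℕ.+ b) ≡ ℕtoℚ a + ℕtoℚ b
  ℕtoℚ-+ a b = toℚᵘ-injective (begin
    ℚ.toℚᵘ (ℕtoℚ (a ℕ.+ b))
      ≈⟨ ℕtoℚᵘ (a ℕ.+ b) ⟩
    ℚᵘ.mkℚᵘ (+ (a ℕ.+ b)) 0
      ≈⟨ ℚᵘ.*≡* (trans (cong (ℤ._* + 1) (ℤP.pos-+ a b)) (cross (+ a) (+ b))) ⟩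
    ℚᵘ.mkℚᵘ (+ a) 0 ℚᵘ.+ ℚᵘ.mkℚᵘ (+ b) 0
      ≈⟨ ℚᵘP.+-cong (ℕtoℚᵘ a) (ℕtoℚᵘ b) ⟨
    ℚ.toℚᵘ (ℕtoℚ a) ℚᵘ.+ ℚ.toℚᵘ (ℕtoℚ b)
      ≈⟨ toℚᵘ-homo-+ (ℕtoℚ a) (ℕtoℚ b) ⟨
    ℚ.toℚᵘ (ℕtoℚ a + ℕtoℚ b)
      ∎)
    where
    open ℚᵘP.≃-Reasoning
    cross : ∀ x y → (x ℤ.+ y) ℤ.* + 1 ≡ (x ℤ.* + 1 ℤ.+ y ℤ.* + 1) ℤ.* + 1
    cross = solve-∀

  ℕtoℚ-* : ∀ a b → ℕtoℚ (a ℕ.* b) ≡ ℕtoℚ a * ℕtoℚ b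
  ℕtoℚ-* a b = toℚᵘ-injective (begin
    ℚ.toℚᵘ (ℕtoℚ (a ℕ.* b))                       ≈⟨ ℕtoℚᵘ (a ℕ.* b) ⟩
    ℚᵘ.mkℚᵘ (+ (a ℕ.* b)) 0                         ≈⟨ ℚᵘ.*≡* (cong (ℤ._* + 1) (ℤP.pos-* a b)) ⟩
    ℚᵘ.mkℚᵘ (+ a) 0 ℚᵘ.* ℚᵘ.mkℚᵘ (+ b) 0             ≈⟨ ℚᵘP.*-cong (ℕtoℚᵘ a) (ℕtoℚᵘ b) ⟨
    ℚ.toℚᵘ (ℕtoℚ a) ℚᵘ.* ℚ.toℚᵘ (ℕtoℚ b)           ≈⟨ toℚᵘ-homo-* (ℕtoℚ a) (ℕtoℚ b) ⟨
    ℚ.toℚᵘ (ℕtoℚ a * ℕtoℚ b)                       ∎)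
    where open ℚᵘP.≃-Reasoning

  ℕtoℚ-⁴ : ∀ a → ℕtoℚ (a ℕ.* a ℕ.* a ℕ.* a) ≡ ℕtoℚ a * ℕtoℚ a * ℕtoℚ a * ℕtoℚ a
  ℕtoℚ-⁴ a = trans (ℕtoℚ-* (a ℕ.* a ℕ.* a) a) (cong (_* ℕtoℚ a)
               (trans (ℕtoℚ-* (a ℕ.* a) a) (cong (_* ℕtoℚ a) (ℕtoℚ-* a a))))

  ℕtoℚ-⁵ : ∀ a → ℕtoℚ (a ℕ.* a ℕ.* a ℕ.* a ℕ.* a) ≡ ℕtoℚ a * ℕtoℚ a * ℕtoℚ a * ℕtoℚ a * ℕtoℚ a
  ℕtoℚ-⁵ a = trans (ℕtoℚ-* (a ℕ.* a ℕ.* a ℕ.* a) a) (cong (_* ℕtoℚ a) (ℕtoℚ-⁴ a))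

  ℕtoℚ-mono-≤ : ∀ {a b} → a ℕ.≤ b → ℕtoℚ a ≤ ℕtoℚ b
  ℕtoℚ-mono-≤ {a} {b} a≤b = toℚᵘ-cancel-≤
    (ℚᵘP.≤-respˡ-≃ (ℚᵘP.≃-sym (ℕtoℚᵘ a)) (ℚᵘP.≤-respʳ-≃ (ℚᵘP.≃-sym (ℕtoℚᵘ b))
      (ℚᵘ.*≤* (subst₂ ℤ._≤_ (ℤP.pos-* a 1) (ℤP.pos-* b 1) (ℤ.+≤+ (ℕP.*-monoˡ-≤ 1 a≤b))))))

  ℕtoℚ-nonNeg : ∀ n → 0ℚ ≤ ℕtoℚ n
  ℕtoℚ-nonNeg n = ℕtoℚ-mono-≤ {0} {n} ℕ.z≤n

  ℕtoℚ-pos : ∀ n .{{_ : ℕ.NonZero n}} → ℚ.Positive (ℕtoℚ n)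
  ℕtoℚ-pos n = normalize-pos n 1

  *-nonNeg : ∀ {a b} → 0ℚ ≤ a → 0ℚ ≤ b → 0ℚ ≤ a * b
  *-nonNeg {a} {b} 0≤a 0≤b =
    nonNegative⁻¹ _ {{nonNeg*nonNeg⇒nonNeg a {{nonNegative 0≤a}} b {{nonNegative 0≤b}}}}

  *-mono-≤-nonNeg : ∀ {a b c d} → 0ℚ ≤ b → 0ℚ ≤ c → a ≤ b → c ≤ d → a * c ≤ b * d
  *-mono-≤-nonNeg {b = b} {c} 0≤b 0≤c a≤b c≤d =
    ≤-trans (*-monoʳ-≤-nonNeg c {{nonNegative 0≤c}} a≤b) (*-monoˡ-≤-nonNeg b {{nonNegative 0≤b}} c≤d)

  ⁴-mono-≤ : ∀ {a b} → 0ℚ ≤ a → a ≤ b → a * a * a * a ≤ b * b * b * b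
  ⁴-mono-≤ 0≤a a≤b = *-mono-≤-nonNeg 0≤b³ 0≤a (*-mono-≤-nonNeg 0≤b² 0≤a a²≤b² a≤b) a≤b
    where
    0≤b = ≤-trans 0≤a a≤b
    0≤b² = *-nonNeg 0≤b 0≤b
    0≤b³ = *-nonNeg 0≤b² 0≤b
    a²≤b² = *-mono-≤-nonNeg 0≤b 0≤a a≤b a≤b

  private
    module ℚΣ = Sum (CommutativeRing.semiring +-*-commutativeRing)

  sumℚ≡sum : ∀ {n} (f : Fin n → ℚ) → sumℚ f ≡ ℚΣ.sum f
  sumℚ≡sum {zero}  f = refl
  sumℚ≡sum {suc n} f = cong (λ r → f zero + r) (sumℚ≡sum (f ∘ suc))

  sumℚ-cong : ∀ {n} {f g : Fin n → ℚ} → (∀ i → f i ≡ g i) → sumℚ f ≡ sumℚ g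
  sumℚ-cong {zero}  _ = refl
  sumℚ-cong {suc n} e = cong₂ _+_ (e zero) (sumℚ-cong (e ∘ suc))

  sumℚ-mono-≤ : ∀ {n} {f g : Fin n → ℚ} → (∀ i → f i ≤ g i) → sumℚ f ≤ sumℚ g
  sumℚ-mono-≤ {zero}  _ = ≤-refl
  sumℚ-mono-≤ {suc n} h = +-mono-≤ (h zero) (sumℚ-mono-≤ (h ∘ suc))

  sumℚ-comm : ∀ {m n} (f : Fin m → Fin n → ℚ) →
    sumℚ (λ i → sumℚ (f i)) ≡ sumℚ (λ j → sumℚ (λ i → f i j))
  sumℚ-comm f = trans (nested f) (trans (ℚΣ.∑-comm f) (sym (nested (λ j i → f i j))))
    where
    nested : ∀ {m n} (g : Fin m → Fin n → ℚ) → sumℚ (λ i → sumℚ (g i)) ≡ ℚΣ.sum (λ i → ℚΣ.sum (g i))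
    nested g = trans (sumℚ≡sum (λ i → sumℚ (g i))) (ℚΣ.sum-cong-≗ (λ i → sumℚ≡sum (g i)))

  sumℚ-*ʳ : ∀ {n} (f : Fin n → ℚ) c → sumℚ (λ i → f i * c) ≡ sumℚ f * c
  sumℚ-*ʳ f c = trans (sumℚ≡sum (λ i → f i * c))
                      (trans (sym (ℚΣ.*-distribʳ-sum c f)) (cong (_* c) (sym (sumℚ≡sum f))))

  sumℚ-indicator : ∀ {n} (f : Fin n → Bool) (c : ℚ) →
    sumℚ (λ i → if f i then c else 0ℚ) ≡ c * ℕtoℚ (count f)
  sumℚ-indicator {zero}  f c = sym (*-zeroʳ c)
  sumℚ-indicator {suc n} f c = begin
    (if f zero then c else 0ℚ) + sumℚ (λ i → if f (suc i) then c else 0ℚ)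
      ≡⟨ cong₂ _+_ (head (f zero)) (sumℚ-indicator (f ∘ suc) c) ⟩
    c * ℕtoℚ (𝟙 (f zero)) + c * ℕtoℚ (count (f ∘ suc))
      ≡⟨ *-distribˡ-+ c _ _ ⟨
    c * (ℕtoℚ (𝟙 (f zero)) + ℕtoℚ (count (f ∘ suc)))
      ≡⟨ cong (c *_) (ℕtoℚ-+ (𝟙 (f zero)) _) ⟨
    c * ℕtoℚ (count f)
      ∎
    where
    open ≡-Reasoning
    head : ∀ b → (if b then c else 0ℚ) ≡ c * ℕtoℚ (𝟙 b)
    head true  = sym (*-identityʳ c)
    head false = sym (*-zeroʳ c)

module FractionalCode {s t : ℕ} (Γ : GQ s t) where

  open import Data.Nat using (suc)
  import Data.Nat.Properties as ℕP
  open import Data.Rational using (0ℚ; 1ℚ; _*_; _≤_; 1/_; nonNegative)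
  open import Data.Rational.Properties
    using (*-identityˡ; *-identityʳ; *-comm; *-cancelʳ-≤-pos; *-monoˡ-≤-nonNeg; *-inverseˡ; pos⇒nonZero;
           pos⇒nonNeg; 1/pos⇒pos; nonNegative⁻¹; module ≤-Reasoning)
  open import Data.Bool using (Bool; true; if_then_else_)
  open import Data.Product using (_,_)
  open import Relation.Binary.PropositionalEquality
  open import Data.Rational.Solver using (module +-*-Solver)
  open Counting using (count-cong; count-true)
  open RationalSums
  open GQ Γ
  open GQProperties Γ

  K : ℕ
  K = suc (s ℕ.* suc t)

  sumℚ-ones : sumℚ {p} (λ _ → 1ℚ) ≡ ℕtoℚ p
  sumℚ-ones = trans (sumℚ-indicator {p} (λ _ → true) 1ℚ) (trans (*-identityˡ _) (cong ℕtoℚ (count-true p)))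

  covering-bound : ∀ (x : Fin p → ℚ) → (∀ u → 1ℚ ≤ sumOver Γ N[ u ] x) → ℕtoℚ p ≤ ℕtoℚ K * sumℚ x
  covering-bound x covers = begin
    ℕtoℚ p
      ≡⟨ sumℚ-ones ⟨
    sumℚ {p} (λ _ → 1ℚ)
      ≤⟨ sumℚ-mono-≤ covers ⟩
    sumℚ (λ u → sumℚ (λ w → if N[ u ] w then x w else 0ℚ))
      ≡⟨ sumℚ-comm (λ u w → if N[ u ] w then x w else 0ℚ) ⟩
    sumℚ (λ w → sumℚ (λ u → if N[ u ] w then x w else 0ℚ))
      ≡⟨ sumℚ-cong (λ w → sumℚ-indicator (λ u → N[ u ] w) (x w)) ⟩
    sumℚ (λ w → x w * ℕtoℚ (count (λ u → N[ u ] w)))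
      ≡⟨ sumℚ-cong (λ w → cong (λ k → x w * ℕtoℚ k) (degree w)) ⟩
    sumℚ (λ w → x w * ℕtoℚ K)
      ≡⟨ sumℚ-*ʳ x (ℕtoℚ K) ⟩
    sumℚ x * ℕtoℚ K
      ≡⟨ *-comm (sumℚ x) (ℕtoℚ K) ⟩
    ℕtoℚ K * sumℚ x
      ∎
    where
    open ≤-Reasoning
    degree : ∀ w → count (λ u → N[ u ] w) ≡ K
    degree w = trans (count-cong (λ u → N-sym u w)) (N-size w)

  lower-bound : p ℕ.* (K ℕ.* K ℕ.* K ℕ.* K) ℕ.≤ 32 ℕ.* (p ℕ.* p ℕ.* p ℕ.* p) →
    ∀ (x : Fin p → ℚ) → FeasibleID Γ x → ℕtoℚ p ≤ ℕtoℚ 32 * (sumℚ x * sumℚ x * sumℚ x * sumℚ x)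
  lower-bound counting x (covers , _) = *-cancelʳ-≤-pos (ℕtoℚ K⁴) {{ℕtoℚ-pos K⁴}} (begin
    ℕtoℚ p * ℕtoℚ K⁴
      ≡⟨ ℕtoℚ-* p K⁴ ⟨
    ℕtoℚ (p ℕ.* K⁴)
      ≤⟨ ℕtoℚ-mono-≤ counting ⟩
    ℕtoℚ (32 ℕ.* (p ℕ.* p ℕ.* p ℕ.* p))
      ≡⟨ trans (ℕtoℚ-* 32 (p ℕ.* p ℕ.* p ℕ.* p)) (cong (ℕtoℚ 32 *_) (ℕtoℚ-⁴ p)) ⟩
    ℕtoℚ 32 * (P * P * P * P)
      ≤⟨ *-monoˡ-≤-nonNeg (ℕtoℚ 32) {{nonNegative (ℕtoℚ-nonNeg 32)}}
           (⁴-mono-≤ (ℕtoℚ-nonNeg p) (covering-bound x covers)) ⟩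
    ℕtoℚ 32 * (k * γ * (k * γ) * (k * γ) * (k * γ))
      ≡⟨ rearrange (ℕtoℚ 32) k γ ⟩
    ℕtoℚ 32 * (γ * γ * γ * γ) * (k * k * k * k)
      ≡⟨ cong (ℕtoℚ 32 * (γ * γ * γ * γ) *_) (ℕtoℚ-⁴ K) ⟨
    ℕtoℚ 32 * (γ * γ * γ * γ) * ℕtoℚ K⁴
      ∎)
    where
    open ≤-Reasoning
    K⁴ = K ℕ.* K ℕ.* K ℕ.* K
    P = ℕtoℚ p
    k = ℕtoℚ K
    γ = sumℚ x
    rearrange : ∀ c k γ → c * (k * γ * (k * γ) * (k * γ) * (k * γ)) ≡ c * (γ * γ * γ * γ) * (k * k * k * k)
    rearrange = solve 3 (λ c k γ → c :* (k :* γ :* (k :* γ) :* (k :* γ) :* (k :* γ)) :=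
                                   c :* (γ :* γ :* γ :* γ) :* (k :* k :* k :* k)) refl
      where open +-*-Solver

  module UniformWeight (2≤s : 2 ℕ.≤ s) (1≤t : 1 ℕ.≤ t) where

    M : ℕ
    M = s ℕ.* t

    1≤M : 1 ℕ.≤ M
    1≤M = ℕP.*-mono-≤ (ℕP.<⇒≤ 2≤s) 1≤t

    private instance
      M-nonZero : ℕ.NonZero M
      M-nonZero = ℕ.>-nonZero 1≤M
      M-positive : ℚ.Positive (ℕtoℚ M)
      M-positive = ℕtoℚ-pos M
      M-nonZeroℚ : ℚ.NonZero (ℕtoℚ M)
      M-nonZeroℚ = pos⇒nonZero (ℕtoℚ M)

    weight : ℚ
    weight = 1/ ℕtoℚ M

    0≤weight : 0ℚ ≤ weight
    0≤weight = nonNegative⁻¹ weight {{pos⇒nonNeg weight {{1/pos⇒pos (ℕtoℚ M)}}}}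

    M≤count⇒1≤sumOver : ∀ (S : Fin p → Bool) → M ℕ.≤ count S → 1ℚ ≤ sumOver Γ S (λ _ → weight)
    M≤count⇒1≤sumOver S M≤S = begin
      1ℚ                          ≡⟨ *-inverseˡ (ℕtoℚ M) ⟨
      weight * ℕtoℚ M             ≤⟨ *-monoˡ-≤-nonNeg weight {{nonNegative 0≤weight}} (ℕtoℚ-mono-≤ M≤S) ⟩
      weight * ℕtoℚ (count S)     ≡⟨ sumℚ-indicator S weight ⟨
      sumOver Γ S (λ _ → weight)  ∎
      where open ≤-Reasoning

    uniform-feasible : FeasibleID Γ (λ _ → weight)
    uniform-feasible =
      (λ u → M≤count⇒1≤sumOver (N[ u ]) (subst (M ℕ.≤_) (sym (N-size u)) M≤K)) ,
      (λ u v u≢v → M≤count⇒1≤sumOver _ (st≤symmetric-difference 2≤s u≢v)) ,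
      (λ _ → 0≤weight , weight≤1)
      where
      M≤K : M ℕ.≤ K
      M≤K = ℕP.≤-trans (ℕP.*-monoʳ-≤ s (ℕP.n≤1+n t)) (ℕP.n≤1+n _)
      weight≤1 : weight ≤ 1ℚ
      weight≤1 = begin
        weight              ≡⟨ *-identityʳ weight ⟨
        weight * 1ℚ         ≤⟨ *-monoˡ-≤-nonNeg weight {{nonNegative 0≤weight}} (ℕtoℚ-mono-≤ 1≤M) ⟩
        weight * ℕtoℚ M     ≡⟨ *-inverseˡ (ℕtoℚ M) ⟩
        1ℚ                  ∎
        where open ≤-Reasoning

    uniform-bound : p ℕ.* p ℕ.* p ℕ.* p ℕ.* p ℕ.≤ 32 ℕ.* (p ℕ.* p) ℕ.* (M ℕ.* M ℕ.* M ℕ.* M ℕ.* M) →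
      let γ = sumℚ {p} (λ _ → weight) in γ * γ * γ * γ * γ ≤ ℕtoℚ 32 * ℕtoℚ (p ℕ.* p)
    uniform-bound counting = *-cancelʳ-≤-pos (ℕtoℚ M⁵) {{M⁵-positive}} (begin
      γ * γ * γ * γ * γ * ℕtoℚ M⁵
        ≡⟨ cong₂ (λ g m → g * g * g * g * g * m) total (ℕtoℚ-⁵ M) ⟩
      w * P * (w * P) * (w * P) * (w * P) * (w * P) * (m * m * m * m * m)
        ≡⟨ rearrange w P m ⟩
      w * m * (w * m) * (w * m) * (w * m) * (w * m) * (P * P * P * P * P)
        ≡⟨ cong (λ c → c * c * c * c * c * (P * P * P * P * P)) (*-inverseˡ m) ⟩
      1ℚ * 1ℚ * 1ℚ * 1ℚ * 1ℚ * (P * P * P * P * P)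
        ≡⟨ *-identityˡ (P * P * P * P * P) ⟩
      P * P * P * P * P
        ≡⟨ ℕtoℚ-⁵ p ⟨
      ℕtoℚ (p ℕ.* p ℕ.* p ℕ.* p ℕ.* p)
        ≤⟨ ℕtoℚ-mono-≤ counting ⟩
      ℕtoℚ (32 ℕ.* (p ℕ.* p) ℕ.* M⁵)
        ≡⟨ trans (ℕtoℚ-* (32 ℕ.* (p ℕ.* p)) M⁵) (cong (_* ℕtoℚ M⁵) (ℕtoℚ-* 32 (p ℕ.* p))) ⟩
      ℕtoℚ 32 * ℕtoℚ (p ℕ.* p) * ℕtoℚ M⁵
        ∎)
      where
      open ≤-Reasoning
      M⁵ = M ℕ.* M ℕ.* M ℕ.* M ℕ.* M
      1≤M⁵ : 1 ℕ.≤ M⁵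
      1≤M⁵ = ℕP.*-mono-≤ (ℕP.*-mono-≤ (ℕP.*-mono-≤ (ℕP.*-mono-≤ 1≤M 1≤M) 1≤M) 1≤M) 1≤M
      M⁵-positive : ℚ.Positive (ℕtoℚ M⁵)
      M⁵-positive = ℕtoℚ-pos M⁵ {{ℕ.>-nonZero 1≤M⁵}}
      w = weight
      P = ℕtoℚ p
      m = ℕtoℚ M
      γ = sumℚ {p} (λ _ → weight)
      total : γ ≡ w * P
      total = trans (sumℚ-indicator {p} (λ _ → true) w) (cong (λ n → w * ℕtoℚ n) (count-true p))
      rearrange : ∀ w P m → w * P * (w * P) * (w * P) * (w * P) * (w * P) * (m * m * m * m * m) ≡
                            w * m * (w * m) * (w * m) * (w * m) * (w * m) * (P * P * P * P * P)
      rearrange = solve 3 (λ w P m →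
        w :* P :* (w :* P) :* (w :* P) :* (w :* P) :* (w :* P) :* (m :* m :* m :* m :* m) :=
        w :* m :* (w :* m) :* (w :* m) :* (w :* m) :* (w :* m) :* (P :* P :* P :* P :* P)) refl
        where open +-*-Solver


module SizeBounds {s t : ℕ} (Γ : GQ s t) where

  open import Data.Nat using (suc; _*_; _≤_)
  import Data.Nat.Properties as ℕP
  open import Data.Product using (proj₁)
  open import Relation.Binary.PropositionalEquality
  open import Data.Nat.Tactic.RingSolver using (solve-∀)
  open Arithmetic using (*-monoʳ-≤-inhabited)
  open Duality using (dual-higman)
  open GQ Γ
  open GQProperties Γ

  -- Scaling by p makes these bounds, which need a point of Γ, hold when there is none.
  p·K⁴≤32p⁴ : 2 ≤ s → 1 ≤ t →
    let K = suc (s * suc t) in p * (K * K * K * K) ≤ 32 * (p * p * p * p)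
  p·K⁴≤32p⁴ 2≤s 1≤t = ℕP.≤-trans (*-monoʳ-≤-inhabited p bound) (ℕP.≤-reflexive (regroup p))
    where
    bound : Fin p → let K = suc (s * suc t) in K * K * K * K ≤ 32 * (p * p * p)
    bound x = subst (λ n → _ ≤ 32 * (n * n * n)) (sym (point-count (proj₁ (line-through x))))
                (Arithmetic.K⁴≤32n³ s t 1≤t (higman 2≤s 1≤t x))
    regroup : ∀ p → p * (32 * (p * p * p)) ≡ 32 * (p * p * p * p)
    regroup = solve-∀

  p⁵≤32p²[st]⁵ : 2 ≤ s → 2 ≤ t → let M = s * t in p * p * p * p * p ≤ 32 * (p * p) * (M * M * M * M * M)
  p⁵≤32p²[st]⁵ 2≤s 2≤t = begin
    p * p * p * p * p           ≡⟨ split p ⟩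
    p * (p * (p * p * p))       ≤⟨ *-monoʳ-≤-inhabited p (λ x → ℕP.*-monoʳ-≤ p (bound x)) ⟩
    p * (p * (32 * M⁵))         ≡⟨ collect p M⁵ ⟩
    32 * (p * p) * M⁵           ∎
    where
    open ℕP.≤-Reasoning
    M⁵ = s * t * (s * t) * (s * t) * (s * t) * (s * t)
    bound : Fin p → p * p * p ≤ 32 * M⁵
    bound x = subst (λ n → n * n * n ≤ 32 * M⁵) (sym (point-count (proj₁ (line-through x))))
                (Arithmetic.n³≤32[st]⁵ s t 2≤s 2≤t (dual-higman Γ 2≤t (ℕP.<⇒≤ 2≤s) x))
    split : ∀ p → p * p * p * p * p ≡ p * (p * (p * p * p))
    split = solve-∀
    collect : ∀ p m → p * (p * (32 * m)) ≡ 32 * (p * p) * m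
    collect = solve-∀

proposition4p11 : ∀ (s t : ℕ) → 1 < s → 1 < t → (Γ : GQ s t) → VertexTransitive Γ →
    let n = GQ.p Γ in
    -- lower bound 2^(-5/4) n^(1/4) ≤ γ : every feasible x has (Σx)^4 ≥ n/32
    (∀ (x : Fin n → ℚ) → FeasibleID Γ x →
      ℕtoℚ n ℚ.≤ ℕtoℚ 32 ℚ.* (sumℚ x ℚ.* sumℚ x ℚ.* sumℚ x ℚ.* sumℚ x))
    ×
    -- upper bound γ ≤ 2 n^(2/5) : some feasible x has (Σx)^5 ≤ 32 n^2
    Σ (Fin n → ℚ) (λ x → FeasibleID Γ x ×
      (sumℚ x ℚ.* sumℚ x ℚ.* sumℚ x ℚ.* sumℚ x ℚ.* sumℚ x) ℚ.≤ ℕtoℚ 32 ℚ.* ℕtoℚ (n ℕ.* n))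
proposition4p11 s t 2≤s 2≤t Γ _ =
  lower-bound (p·K⁴≤32p⁴ 2≤s 1≤t) ,
  ((λ _ → weight) , uniform-feasible , uniform-bound (p⁵≤32p²[st]⁵ 2≤s 2≤t))
  where
  1≤t = ℕP.<⇒≤ 2≤t
  open SizeBounds Γ
  open FractionalCode Γ
  open UniformWeight 2≤s 1≤t
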